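{- Let $p$ be an odd prime and $q=p^m$ with $m\ge1$. Let $l,e,r,s$ be positive integers such that $l\ge3$ is odd, $s$ is even, $\gcd(l,e)=1$, $l\mid r+es$, and $q-1=ls$. Let $\gamma$ be a primitive element of $\mathbb{F}_q$, $\xi=\gamma^s$, and $A_k=\xi^{ek}+1$ for $0\le k\le l-1$. Then $P(x)=x^r(x^{es}+1)$ is a permutation polynomial of $\mathbb{F}_q$ if and only if all of the following hold: $\gcd(r,s)=1$; $p\mid 2^s-1$; $l\nmid r$; the elements $A_1^s,A_2^s,\dots,A_{l-1}^s$ are pairwise distinct ($l$-th roots of unity); and $\mathrm{Ind}_\gamma(A_k)+kr\not\equiv \mathrm{Ind}_\gamma(2)\pmod l$ for all $k=1,2,\dots,l-1$.
   Context: For $a\in\mathbb{F}_q^\ast$, $\mathrm{Ind}_\gamma(a)$ is the residue class $b\bmod(q-1)$ with $a=\gamma^b$; congruences modulo $l$ are well defined since $l\mid q-1$. Here $A_k=f(\xi^k)$ for $f(x)=x^e+1$, and all $A_k$ are nonzero. -}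

module Defs where

open import Data.Nat using (ℕ; zero; suc)
import Data.Nat as ℕ
open import Data.Fin using (Fin)
open import Data.Product using (∃; ∃₂; _×_)
open import Function.Bundles using (_↔_)
open import Function.Definitions using (Bijective)
open import Relation.Binary.PropositionalEquality using (_≡_)
open import Relation.Nullary using (¬_)
open import Algebra.Structures using (IsCommutativeRing)

_≡_[mod_] : ℕ → ℕ → ℕ → Set
a ≡ b [mod n ] = ∃₂ λ x y → a ℕ.+ x ℕ.* n ≡ b ℕ.+ y ℕ.* n

record FiniteField (q : ℕ) : Set₁ where
  infixl 8 _^_
  infixl 7 _*_
  infixl 6 _+_
  field
    Carrier : Set
    _+_ _*_ : Carrier → Carrier → Carrier
    -_      : Carrier → Carrier
    0# 1#   : Carrier
    isCommutativeRing : IsCommutativeRing _≡_ _+_ _*_ -_ 0# 1#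
    0≢1     : ¬ (0# ≡ 1#)
    inverse : ∀ x → ¬ (x ≡ 0#) → ∃ λ y → x * y ≡ 1#
    enum    : Carrier ↔ Fin q

  _^_ : Carrier → ℕ → Carrier
  x ^ zero  = 1#
  x ^ suc n = x * (x ^ n)

  2# : Carrier
  2# = 1# + 1#

  IsPrimitive : Carrier → Set
  IsPrimitive γ = ¬ (γ ≡ 0#) × (∀ a → ¬ (a ≡ 0#) → ∃ λ b → γ ^ b ≡ a)

  IsPermutation : (Carrier → Carrier) → Set
  IsPermutation f = Bijective _≡_ _≡_ f

module _ {q : ℕ} (F : FiniteField q) where
  open FiniteField F

  A[_,_,_,_] : Carrier → ℕ → ℕ → ℕ → Carrier
  A[ γ , s , e , k ] = (γ ^ s) ^ (e ℕ.* k) + 1#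

  P[_,_,_] : ℕ → ℕ → ℕ → Carrier → Carrier
  P[ r , e , s ] x = x ^ r * (x ^ (e ℕ.* s) + 1#)

module Submission where

-- Write every nonzero x as γ ^ i. Then P (γ ^ i) = γ ^ (r i) · A i, where A i only depends on i mod l, and
-- P (γ ^ i) ^ s = G i := ξ ^ (i r) · A i ^ s. As l ∣ r + e s, G j = A (l − j) ^ s, so G is injective on the
-- residues mod l exactly when the A k ^ s (0 < k < l) are distinct and G k ≠ G 0 = ξ ^ Ind 2 (the index
-- condition). P is injective iff gcd (r, s) = 1 and G is injective on residues; injectivity gives
-- surjectivity by finiteness.
-- Conversely, if P is surjective then k ↦ k r + Ind (A k) permutes the residues mod l, so, l being odd,
-- Σ Ind (A k) ≡ Σ k ≡ 0 (mod l). The doubling identity (1 + x) (1 − x) = 1 − x², with x = ξ ^ (e k), summed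
-- along the permutation k ↦ 2 k gives Σ Ind (A k) ≡ Ind (A 0) = Ind 2 (mod q − 1), hence
-- 2 ^ s = ξ ^ (Σ Ind (A k)) = 1 in F_q, i.e. p ∣ 2 ^ s − 1. Finally l ∤ r since l ∣ r + e s, gcd (l, e) = 1
-- and gcd (r, s) = 1; 2 ≠ 0 in F_q because p is odd.

open import Defs
open import Data.Nat as ℕ using (ℕ; zero; suc; _≤_; _<_; z≤n; s≤s; NonZero)
import Data.Nat.Properties as ℕ
open import Data.Nat.DivMod using (_%_; m%n<n; m<n⇒m%n≡m)
open import Data.Nat.Divisibility using (_∣_; _∣?_; divides; ∣-refl)
open import Data.Nat.GCD using (module Bézout; gcd; gcd[m,n]∣m; gcd[m,n]∣n; gcd[m,n]≢0)
open import Data.Nat.Coprimality using (Coprime; gcd≡1⇒coprime; coprime-Bézout)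
import Data.Nat.Coprimality as Coprimality
open import Data.Nat.Primality using (Prime; prime⇒irreducible; prime[2]; ¬prime[1])
open import Data.Product using (∃; _×_; _,_; proj₁; proj₂)
open import Data.Sum using (_⊎_; inj₁; inj₂)
open import Data.Fin using (Fin; zero; suc; toℕ; fromℕ<; punchOut)
open import Data.Fin.Properties
  using (any?; pigeonhole; cantor-schröder-bernstein; toℕ-injective; toℕ<n; toℕ-fromℕ<; toℕ-fromℕ;
         toℕ-inject₁; punchOut-injective; injective⇒≤)
  renaming (_≟_ to _≟ᶠ_)
open import Data.Fin.Permutation using (Permutation; permutation)
open import Function using (_∘_)
open import Function.Bundles using (Inverse; _⇔_; mk⇔; Equivalence)
open import Function.Definitions using (Injective; StrictlySurjective)
open import Relation.Binary.Definitions using (DecidableEquality; tri<; tri≈; tri>)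
open import Relation.Binary.PropositionalEquality
open import Relation.Nullary using (¬_; yes; no; contradiction)
open import Relation.Nullary.Decidable using (_×-dec_)
open import Relation.Unary using (Decidable)
open import Algebra.Bundles using (CommutativeMonoid; CommutativeRing)
import Algebra.Properties.CommutativeMonoid.Sum as Sum
import Algebra.Properties.Semiring.Exp

module Arithmetic where
  open import Data.Nat using (_+_; _*_; _∸_)
  open import Data.Nat.Properties
  open import Data.Nat.DivMod
  open import Data.Nat.Divisibility using (*-monoʳ-∣; *-cancelˡ-∣; ∣m+n∣m⇒∣n; ∣1⇒≡1)
  open import Data.Nat.GCD using (gcd-greatest)
  open import Data.Nat.Coprimality using (coprime-divisor)
  open import Data.Nat.Tactic.RingSolver using (solve-∀)
  open import Data.Nat.Induction using (<-rec)
  open Sum +-0-commutativeMonoid public using (∑-distrib-+) renaming (sum to ∑)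
  open Sum +-0-commutativeMonoid using () renaming (sum-init-last to ∑-init-last; sum-cong-≗ to ∑-cong-≗)
  open import Algebra.Properties.Semiring.Sum +-*-semiring public using () renaming (*-distribʳ-sum to *-distribʳ-∑)
  open ≡-Reasoning

  private
    scale-distrib : ∀ s a x n → s * a + x * (n * s) ≡ s * (a + x * n)
    scale-distrib = solve-∀

  ≡-mod-refl : ∀ {a n} → a ≡ a [mod n ]
  ≡-mod-refl = 0 , 0 , refl

  ≡-mod-sym : ∀ {a b n} → a ≡ b [mod n ] → b ≡ a [mod n ]
  ≡-mod-sym (x , y , eq) = y , x , sym eq

  ≡⇒≡-mod : ∀ {a b n} → a ≡ b → a ≡ b [mod n ]
  ≡⇒≡-mod refl = ≡-mod-refl

  ≡-mod-trans : ∀ {a b c n} → a ≡ b [mod n ] → b ≡ c [mod n ] → a ≡ c [mod n ]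
  ≡-mod-trans {a} {b} {c} {n} (x , y , a≈b) (u , v , b≈c) = x + u , y + v , (begin
    a + (x + u) * n   ≡⟨ shift a x u n ⟩
    a + x * n + u * n ≡⟨ cong (_+ u * n) a≈b ⟩
    b + y * n + u * n ≡⟨ swap b y u n ⟩
    b + u * n + y * n ≡⟨ cong (_+ y * n) b≈c ⟩
    c + v * n + y * n ≡⟨ swap c v y n ⟩
    c + y * n + v * n ≡⟨ shift c y v n ⟨
    c + (y + v) * n   ∎)
    where
    shift : ∀ a x u n → a + (x + u) * n ≡ a + x * n + u * n
    shift = solve-∀
    swap : ∀ b y u n → b + y * n + u * n ≡ b + u * n + y * n
    swap = solve-∀

  +-multiple-≡-mod : ∀ a k n → (a + k * n) ≡ a [mod n ]
  +-multiple-≡-mod a k n = 0 , k , +-identityʳ _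

  multiple-≡-mod-0 : ∀ k n → (k * n) ≡ 0 [mod n ]
  multiple-≡-mod-0 = +-multiple-≡-mod 0

  +-cong-≡-mod : ∀ {a b c d n} → a ≡ b [mod n ] → c ≡ d [mod n ] → (a + c) ≡ (b + d) [mod n ]
  +-cong-≡-mod {a} {b} {c} {d} {n} (x , y , a≈b) (u , v , c≈d) = x + u , y + v ,
    trans (interchange a c x u n) (trans (cong₂ _+_ a≈b c≈d) (sym (interchange b d y v n)))
    where
    interchange : ∀ a c x u n → a + c + (x + u) * n ≡ a + x * n + (c + u * n)
    interchange = solve-∀

  *-congˡ-≡-mod : ∀ {a b n} c → a ≡ b [mod n ] → (c * a) ≡ (c * b) [mod n ]
  *-congˡ-≡-mod {a} {b} {n} c (x , y , a≈b) = c * x , c * y ,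
    trans (distrib c a x n) (trans (cong (c *_) a≈b) (sym (distrib c b y n)))
    where
    distrib : ∀ c a x n → c * a + c * x * n ≡ c * (a + x * n)
    distrib = solve-∀

  *-congʳ-≡-mod : ∀ {a b n} c → a ≡ b [mod n ] → (a * c) ≡ (b * c) [mod n ]
  *-congʳ-≡-mod {a} {b} {n} c = subst₂ (_≡_[mod n ]) (*-comm c a) (*-comm c b) ∘ *-congˡ-≡-mod c

  +-cancelʳ-≡-mod : ∀ {a b c n} → (a + c) ≡ (b + c) [mod n ] → a ≡ b [mod n ]
  +-cancelʳ-≡-mod {a} {b} {c} {n} (x , y , eq) = x , y ,
    +-cancelʳ-≡ c _ _ (trans (swap a c x n) (trans eq (sym (swap b c y n))))
    where
    swap : ∀ a c x n → a + x * n + c ≡ a + c + x * n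
    swap = solve-∀

  ≡-mod-scale : ∀ {a b n} s → a ≡ b [mod n ] → (s * a) ≡ (s * b) [mod n * s ]
  ≡-mod-scale {a} {b} {n} s (x , y , a≈b) = x , y ,
    trans (scale-distrib s a x n) (trans (cong (s *_) a≈b) (sym (scale-distrib s b y n)))

  ≡-mod-unscale : ∀ {a b n} s .{{_ : NonZero s}} → (s * a) ≡ (s * b) [mod n * s ] → a ≡ b [mod n ]
  ≡-mod-unscale {a} {b} {n} s (x , y , eq) = x , y ,
    *-cancelˡ-≡ _ _ s (trans (sym (scale-distrib s a x n)) (trans eq (scale-distrib s b y n)))

  ≡-mod-% : ∀ a n .{{_ : NonZero n}} → a ≡ (a % n) [mod n ]
  ≡-mod-% a n = 0 , a / n , trans (+-identityʳ a) (m≡m%n+[m/n]*n a n)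

  ≡-mod⇒%≡ : ∀ {a b n} → .{{_ : NonZero n}} → a ≡ b [mod n ] → a % n ≡ b % n
  ≡-mod⇒%≡ {a} {b} {n} (x , y , eq) =
    trans (sym ([m+kn]%n≡m%n a x n)) (trans (cong (_% n) eq) ([m+kn]%n≡m%n b y n))

  %≡⇒≡-mod : ∀ {a b n} → .{{_ : NonZero n}} → a % n ≡ b % n → a ≡ b [mod n ]
  %≡⇒≡-mod {a} {b} {n} eq =
    ≡-mod-trans (≡-mod-% a n) (≡-mod-trans (≡⇒≡-mod eq) (≡-mod-sym (≡-mod-% b n)))

  ≡-mod⇒≡ : ∀ {a b n} → .{{_ : NonZero n}} → a < n → b < n → a ≡ b [mod n ] → a ≡ b
  ≡-mod⇒≡ a<n b<n eq = trans (sym (m<n⇒m%n≡m a<n)) (trans (≡-mod⇒%≡ eq) (m<n⇒m%n≡m b<n))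

  ≡-mod⇒∣∸ : ∀ {a b n} → a ≤ b → a ≡ b [mod n ] → n ∣ b ∸ a
  ≡-mod⇒∣∸ {a} {b} {n} a≤b (x , y , eq) = divides (x ∸ y) (begin
    b ∸ a                     ≡⟨ [m+n]∸[m+o]≡n∸o (y * n) b a ⟨
    (y * n + b) ∸ (y * n + a) ≡⟨ cong₂ _∸_ (+-comm (y * n) b) (+-comm (y * n) a) ⟩
    (b + y * n) ∸ (a + y * n) ≡⟨ cong (_∸ (a + y * n)) eq ⟨
    (a + x * n) ∸ (a + y * n) ≡⟨ [m+n]∸[m+o]≡n∸o a (x * n) (y * n) ⟩
    x * n ∸ y * n             ≡⟨ *-distribʳ-∸ n x y ⟨
    (x ∸ y) * n               ∎)

  ∣∸⇒≡-mod : ∀ {a b n} → a ≤ b → n ∣ b ∸ a → a ≡ b [mod n ]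
  ∣∸⇒≡-mod {a} {b} a≤b (divides k eq) =
    k , 0 , trans (cong (a +_) (sym eq)) (trans (m+[n∸m]≡n a≤b) (sym (+-identityʳ b)))

  ≡-mod-wlog : ∀ {a b n} (R : ℕ → ℕ → Set) → (∀ {a b} → R a b → R b a) →
               (∀ {a b} → a ≤ b → R a b → a ≡ b [mod n ]) → R a b → a ≡ b [mod n ]
  ≡-mod-wlog {a = a} {b} R R-sym ≤-case r with ≤-total a b
  ... | inj₁ a≤b = ≤-case a≤b r
  ... | inj₂ b≤a = ≡-mod-sym (≤-case b≤a (R-sym r))

  *-cancelˡ-≡-mod : ∀ {a b c n} → Coprime n c → (c * a) ≡ (c * b) [mod n ] → a ≡ b [mod n ]
  *-cancelˡ-≡-mod {c = c} {n} coprime = ≡-mod-wlog (λ a b → (c * a) ≡ (c * b) [mod n ]) ≡-mod-sym cancel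
    where
    cancel : ∀ {a b} → a ≤ b → (c * a) ≡ (c * b) [mod n ] → a ≡ b [mod n ]
    cancel {a} {b} a≤b eq = ∣∸⇒≡-mod a≤b (coprime-divisor coprime
      (subst (n ∣_) (sym (*-distribˡ-∸ c b a)) (≡-mod⇒∣∸ (*-monoʳ-≤ c a≤b) eq)))

  ≡-mod-lift : ∀ {i j l r s} .{{_ : NonZero l}} → Coprime s r →
               i ≡ j [mod l ] → (r * i) ≡ (r * j) [mod l * s ] → i ≡ j [mod l * s ]
  ≡-mod-lift {l = l} {r} {s} coprime i≡j ri≡rj =
    ≡-mod-wlog (λ i j → i ≡ j [mod l ] × (r * i) ≡ (r * j) [mod l * s ])
               (λ (p , q) → ≡-mod-sym p , ≡-mod-sym q) lift (i≡j , ri≡rj)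
    where
    lift : ∀ {i j} → i ≤ j → i ≡ j [mod l ] × (r * i) ≡ (r * j) [mod l * s ] → i ≡ j [mod l * s ]
    lift {i} {j} i≤j (i≡j , ri≡rj) with ≡-mod⇒∣∸ i≤j i≡j
    ... | divides t j∸i≡tl = ∣∸⇒≡-mod i≤j (subst (l * s ∣_) (trans (*-comm l t) (sym j∸i≡tl))
          (*-monoʳ-∣ l (coprime-divisor coprime (*-cancelˡ-∣ l (subst (l * s ∣_) rj∸ri≡lrt
            (≡-mod⇒∣∸ (*-monoʳ-≤ r i≤j) ri≡rj))))))
      where
      rearrange : ∀ r t l → r * (t * l) ≡ l * (r * t)
      rearrange = solve-∀
      rj∸ri≡lrt : r * j ∸ r * i ≡ l * (r * t)
      rj∸ri≡lrt = trans (sym (*-distribˡ-∸ r j i)) (trans (cong (r *_) j∸i≡tl) (rearrange r t l))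

  ∣r+es⇒∤r : ∀ {l e r s} → 2 ≤ l → gcd l e ≡ 1 → gcd r s ≡ 1 → l ∣ r + e * s → ¬ l ∣ r
  ∣r+es⇒∤r {l} {e} {r} {s} 2≤l gcd[l,e]≡1 gcd[r,s]≡1 l∣r+es l∣r =
    <⇒≢ 2≤l (sym (∣1⇒≡1 (subst (l ∣_) gcd[r,s]≡1 (gcd-greatest l∣r l∣s))))
    where
    l∣s : l ∣ s
    l∣s = coprime-divisor (gcd≡1⇒coprime gcd[l,e]≡1) (∣m+n∣m⇒∣n l∣r+es l∣r)

  ∤⇒coprime : ∀ {p n} → Prime p → ¬ p ∣ n → Coprime p n
  ∤⇒coprime p-prime p∤n (d∣p , d∣n) with prime⇒irreducible p-prime d∣p
  ... | inj₁ d≡1 = d≡1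
  ... | inj₂ refl = contradiction d∣n p∤n

  least-witness : ∀ {ℓ} {P : ℕ → Set ℓ} → Decidable P → ∀ {k} → P k →
                  ∃ λ n → P n × (∀ {m} → m < n → ¬ P m)
  least-witness {P = P} P? {k} = <-rec (λ k → P k → _) search k
    where
    search : ∀ k → (∀ {j} → j < k → P j → ∃ λ n → P n × (∀ {m} → m < n → ¬ P m)) →
             P k → ∃ λ n → P n × (∀ {m} → m < n → ¬ P m)
    search k smaller Pk with any? (λ (i : Fin k) → P? (toℕ i))
    ... | yes (i , Pi) = smaller (toℕ<n i) Pi
    ... | no none = k , Pk , λ m<k Pm → none (fromℕ< m<k , subst P (sym (toℕ-fromℕ< m<k)) Pm)

  section-injective : ∀ {A B : Set} {f : A → B} (surj : StrictlySurjective _≡_ f) →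
                      Injective _≡_ _≡_ (proj₁ ∘ surj)
  section-injective {f = f} surj {x} {y} eq =
    trans (sym (proj₂ (surj x))) (trans (cong f eq) (proj₂ (surj y)))

  -- A point missed by f would let punchOut squeeze f into an injection Fin n → Fin (n ∸ 1).
  Fin-injective⇒strictlySurjective : ∀ {n} {f : Fin n → Fin n} →
                                     Injective _≡_ _≡_ f → StrictlySurjective _≡_ f
  Fin-injective⇒strictlySurjective {suc n} {f} f-inj y with any? (λ x → f x ≟ᶠ y)
  ... | yes hit = hit
  ... | no miss = contradiction (injective⇒≤ squeeze-injective) (<-irrefl refl)
    where
    y≢f : ∀ x → y ≢ f x
    y≢f x y≡fx = miss (x , sym y≡fx)
    squeeze-injective : Injective _≡_ _≡_ (λ x → punchOut (y≢f x))
    squeeze-injective eq = f-inj (punchOut-injective (y≢f _) (y≢f _) eq)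

  module _ {n} {f : Fin n → Fin n} where

    Fin-strictlySurjective⇒injective : StrictlySurjective _≡_ f → Injective _≡_ _≡_ f
    Fin-strictlySurjective⇒injective f-surj {x} {y} fx≡fy =
      trans (sym (g∘f x)) (trans (cong g fx≡fy) (g∘f y))
      where
      g : Fin n → Fin n
      g = proj₁ ∘ f-surj
      g∘f : ∀ x → g (f x) ≡ x
      g∘f x with Fin-injective⇒strictlySurjective (section-injective f-surj) x
      ... | z , gz≡x = trans (cong (g ∘ f) (sym gz≡x)) (trans (cong g (proj₂ (f-surj z))) gz≡x)

    Fin-injective⇒permutation : Injective _≡_ _≡_ f → Permutation n n
    Fin-injective⇒permutation f-inj =
      permutation f (proj₁ ∘ f-surj) (proj₂ ∘ f-surj) (f-inj ∘ proj₂ ∘ f-surj ∘ f)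
      where f-surj = Fin-injective⇒strictlySurjective f-inj

  module _ {a ℓ} (M : CommutativeMonoid a ℓ) where
    open CommutativeMonoid M
    open Sum M

    sum-reindex : ∀ {n} (f : Fin n → Carrier) {σ : Fin n → Fin n} →
                  Injective _≡_ _≡_ σ → sum f ≈ sum (f ∘ σ)
    sum-reindex f σ-inj = sum-permute f (Fin-injective⇒permutation σ-inj)

  ∑-≡-mod : ∀ {n M} {f g : Fin n → ℕ} → (∀ i → f i ≡ g i [mod M ]) → ∑ f ≡ ∑ g [mod M ]
  ∑-≡-mod {zero} f≡g = ≡-mod-refl
  ∑-≡-mod {suc n} f≡g = +-cong-≡-mod (f≡g _) (∑-≡-mod (f≡g ∘ Data.Fin.suc))

  ∑-toℕ-suc : ∀ n → ∑ {suc n} toℕ ≡ ∑ {n} toℕ + n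
  ∑-toℕ-suc n = trans (∑-init-last {n} toℕ) (cong₂ _+_ (∑-cong-≗ {n} toℕ-inject₁) (toℕ-fromℕ n))

  double-∑-toℕ : ∀ n → 2 * ∑ {n} toℕ + n ≡ n * n
  double-∑-toℕ zero = refl
  double-∑-toℕ (suc n) = begin
    2 * ∑ {suc n} toℕ + suc n       ≡⟨ cong (λ S → 2 * S + suc n) (∑-toℕ-suc n) ⟩
    2 * (S + n) + suc n             ≡⟨ regroup S n ⟩
    (2 * S + n) + (2 * n + 1)       ≡⟨ cong (_+ (2 * n + 1)) (double-∑-toℕ n) ⟩
    n * n + (2 * n + 1)             ≡⟨ square n ⟩
    suc n * suc n                   ∎
    where
    S = ∑ {n} toℕ
    regroup : ∀ S n → 2 * (S + n) + suc n ≡ (2 * S + n) + (2 * n + 1)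
    regroup = solve-∀
    square : ∀ n → n * n + (2 * n + 1) ≡ suc n * suc n
    square = solve-∀

  ∑-toℕ≡0-mod-odd : ∀ {n} → ¬ 2 ∣ n → ∑ {n} toℕ ≡ 0 [mod n ]
  ∑-toℕ≡0-mod-odd {n} 2∤n = *-cancelˡ-≡-mod (Coprimality.sym (∤⇒coprime prime[2] 2∤n))
    (+-cancelʳ-≡-mod (≡-mod-trans (≡⇒≡-mod (double-∑-toℕ n))
      (≡-mod-trans (multiple-≡-mod-0 n n) (≡-mod-sym n≡0))))
    where
    n≡0 : n ≡ 0 [mod n ]
    n≡0 = subst (_≡ 0 [mod n ]) (*-identityˡ n) (multiple-≡-mod-0 1 n)

  -- Summing the relations over i ≠ i₀ and using ∑ (d ∘ σ) = ∑ d, where σ fixes i₀,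
  -- leaves ∑_{i ≠ i₀} b i ≡ 0.
  ∑-≡-head : ∀ {n M} (b d : Fin n → ℕ) {σ : Fin n → Fin n} → Injective _≡_ _≡_ σ →
             ∀ i₀ → toℕ i₀ ≡ 0 → toℕ (σ i₀) ≡ 0 →
             (∀ i → 1 ≤ toℕ i → (b i + d i) ≡ d (σ i) [mod M ]) → ∑ b ≡ b i₀ [mod M ]
  ∑-≡-head {suc n} {M} b d {σ} σ-inj zero _ σ₀≡0 step =
    ≡-mod-trans (+-cong-≡-mod (≡-mod-refl {b zero}) tail-b≡0) (≡⇒≡-mod (+-identityʳ (b zero)))
    where
    tail-d≡ : ∑ (d ∘ suc) ≡ ∑ (d ∘ σ ∘ suc)
    tail-d≡ = +-cancelˡ-≡ (d zero) _ _ (trans (sum-reindex +-0-commutativeMonoid d σ-inj)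
                (cong (λ i → d i + ∑ (d ∘ σ ∘ suc)) (toℕ-injective σ₀≡0)))
    tail-b≡0 : ∑ (b ∘ suc) ≡ 0 [mod M ]
    tail-b≡0 = +-cancelʳ-≡-mod (≡-mod-trans (≡⇒≡-mod (sym (∑-distrib-+ (b ∘ suc) (d ∘ suc))))
                 (≡-mod-trans (∑-≡-mod (λ i → step (suc i) (s≤s z≤n))) (≡⇒≡-mod (sym tail-d≡))))

open Arithmetic

module FieldProperties {q} (F : FiniteField q) where
  open FiniteField F
  open ≡-Reasoning

  ring : CommutativeRing _ _
  ring = record { isCommutativeRing = isCommutativeRing }

  open CommutativeRing ring using (+-commutativeMonoid)
  open CommutativeRing ring public
    using (_-_; +-comm; +-identityʳ; -‿inverseʳ; *-assoc; *-comm; *-identityˡ; *-identityʳ; distribˡ; zeroˡ; zeroʳ)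
  open import Algebra.Properties.Ring (CommutativeRing.ring ring) public
    using (+-cancelˡ; +-cancelʳ; x∙y⁻¹≈ε⇒x≈y; -‿distribʳ-*)
  open import Algebra.Properties.Semiring.Mult (CommutativeRing.semiring ring) public
    using (×1-homo-*) renaming (_×_ to _ℕ×_)
  open Sum +-commutativeMonoid
    using (sum; sum-replicate; sum-cong-≗) renaming (∑-distrib-+ to sum-distrib-+)
  module Exp = Algebra.Properties.Semiring.Exp (CommutativeRing.semiring ring)

  toFin : Carrier → Fin q
  toFin = Inverse.to enum

  fromFin : Fin q → Carrier
  fromFin = Inverse.from enum

  fromFin-toFin : ∀ x → fromFin (toFin x) ≡ x
  fromFin-toFin x = Inverse.inverseʳ enum refl

  toFin-fromFin : ∀ i → toFin (fromFin i) ≡ i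
  toFin-fromFin i = Inverse.inverseˡ enum refl

  fromFin-injective : Injective _≡_ _≡_ fromFin
  fromFin-injective {i} {j} eq = trans (sym (toFin-fromFin i)) (trans (cong toFin eq) (toFin-fromFin j))

  toFin-injective : Injective _≡_ _≡_ toFin
  toFin-injective {x} {y} eq = trans (sym (fromFin-toFin x)) (trans (cong fromFin eq) (fromFin-toFin y))

  infix 4 _≟_
  _≟_ : DecidableEquality Carrier
  x ≟ y with toFin x ≟ᶠ toFin y
  ... | yes eq = yes (toFin-injective eq)
  ... | no neq = no (neq ∘ cong toFin)

  *-cancelˡ : ∀ {x a b} → x ≢ 0# → x * a ≡ x * b → a ≡ b
  *-cancelˡ {x} {a} {b} x≢0 eq with inverse x x≢0
  ... | y , xy≡1 = begin
    a             ≡⟨ *-identityˡ a ⟨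
    1# * a        ≡⟨ cong (_* a) (trans (sym xy≡1) (*-comm x y)) ⟩
    y * x * a     ≡⟨ *-assoc y x a ⟩
    y * (x * a)   ≡⟨ cong (y *_) eq ⟩
    y * (x * b)   ≡⟨ *-assoc y x b ⟨
    y * x * b     ≡⟨ cong (_* b) (trans (*-comm y x) xy≡1) ⟩
    1# * b        ≡⟨ *-identityˡ b ⟩
    b             ∎

  *-cancelʳ : ∀ {x a b} → x ≢ 0# → a * x ≡ b * x → a ≡ b
  *-cancelʳ {x} {a} {b} x≢0 eq = *-cancelˡ x≢0 (trans (*-comm x a) (trans eq (*-comm b x)))

  *-nonZero : ∀ {x y} → x ≢ 0# → y ≢ 0# → x * y ≢ 0#
  *-nonZero {x} x≢0 y≢0 xy≡0 = y≢0 (*-cancelˡ x≢0 (trans xy≡0 (sym (zeroʳ x))))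

  ^≡^ : ∀ x n → x ^ n ≡ x Exp.^ n
  ^≡^ x zero = refl
  ^≡^ x (suc n) = cong (x *_) (^≡^ x n)

  ^-homo-* : ∀ x m n → x ^ (m ℕ.+ n) ≡ x ^ m * x ^ n
  ^-homo-* x m n rewrite ^≡^ x (m ℕ.+ n) | ^≡^ x m | ^≡^ x n = Exp.^-homo-* x m n

  ^-assocʳ : ∀ x m n → (x ^ m) ^ n ≡ x ^ (m ℕ.* n)
  ^-assocʳ x m n rewrite ^≡^ (x ^ m) n | ^≡^ x m | ^≡^ x (m ℕ.* n) = Exp.^-assocʳ x m n

  ^-distrib-* : ∀ x y n → (x * y) ^ n ≡ x ^ n * y ^ n
  ^-distrib-* x y zero = sym (*-identityˡ 1#)
  ^-distrib-* x y (suc n) = begin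
    x * y * (x * y) ^ n       ≡⟨ cong (x * y *_) (^-distrib-* x y n) ⟩
    x * y * (x ^ n * y ^ n)   ≡⟨ interchange x y (x ^ n) (y ^ n) ⟩
    x * x ^ n * (y * y ^ n)   ∎
    where
    open import Algebra.Properties.CommutativeSemigroup (CommutativeRing.*-commutativeSemigroup ring)
      using (interchange)

  1^ : ∀ n → 1# ^ n ≡ 1#
  1^ zero = refl
  1^ (suc n) = trans (*-identityˡ _) (1^ n)

  ^-nonZero : ∀ {x} n → x ≢ 0# → x ^ n ≢ 0#
  ^-nonZero zero x≢0 1≡0 = 0≢1 (sym 1≡0)
  ^-nonZero (suc n) x≢0 = *-nonZero x≢0 (^-nonZero n x≢0)

  ×1-homo-^ : ∀ m n → (m ℕ.^ n) ℕ× 1# ≡ (m ℕ× 1#) ^ n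
  ×1-homo-^ m zero = +-identityʳ 1#
  ×1-homo-^ m (suc n) = trans (×1-homo-* m (m ℕ.^ n)) (cong ((m ℕ× 1#) *_) (×1-homo-^ m n))

  -- Translating by 1 permutes the field, so adding 1 to every element leaves the sum unchanged.
  q×1≡0 : q ℕ× 1# ≡ 0#
  q×1≡0 = +-cancelˡ S (q ℕ× 1#) 0# (begin
    S + q ℕ× 1#                         ≡⟨ cong (S +_) (sum-replicate q) ⟨
    S + sum {q} (λ _ → 1#)              ≡⟨ sum-distrib-+ fromFin (λ _ → 1#) ⟨
    sum (λ i → fromFin i + 1#)          ≡⟨ sum-cong-≗ (λ i → fromFin-toFin (fromFin i + 1#)) ⟨
    sum (fromFin ∘ shift)               ≡⟨ sum-reindex +-commutativeMonoid fromFin shift-injective ⟨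
    S                                   ≡⟨ +-identityʳ S ⟨
    S + 0#                              ∎)
    where
    S = sum fromFin
    shift : Fin q → Fin q
    shift i = toFin (fromFin i + 1#)
    shift-injective : Injective _≡_ _≡_ shift
    shift-injective eq = fromFin-injective (+-cancelʳ 1# _ _ (toFin-injective eq))

  [x+1][1-x]≡1-x² : ∀ x → (x + 1#) * (1# - x) ≡ 1# - x * x
  [x+1][1-x]≡1-x² x = begin
    (x + 1#) * (1# + - x)      ≡⟨ expand x (- x) ⟩
    1# + x * - x + (x - x)     ≡⟨ cong (1# + x * - x +_) (-‿inverseʳ x) ⟩
    1# + x * - x + 0#          ≡⟨ +-identityʳ _ ⟩
    1# + x * - x               ≡⟨ cong (1# +_) (-‿distribʳ-* x x) ⟨
    1# - x * x                 ∎
    where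
    open import Algebra.Solver.Ring.NaturalCoefficients.Default (CommutativeRing.commutativeSemiring ring)
    expand : ∀ x y → (x + 1#) * (1# + y) ≡ 1# + x * y + (x + y)
    expand = solve 2 (λ x y → (x :+ con 1) :* (con 1 :+ y) := con 1 :+ x :* y :+ (x :+ y)) refl

  2ℕ×1≡2# : 2 ℕ× 1# ≡ 2#
  2ℕ×1≡2# = cong (1# +_) (+-identityʳ 1#)

  vanishing-multiple : ∀ a {k} → k ℕ× 1# ≡ 0# → (a ℕ.* k) ℕ× 1# ≡ 0#
  vanishing-multiple a {k} k≡0 = trans (×1-homo-* a k) (trans (cong (a ℕ× 1# *_) k≡0) (zeroʳ _))

  no-unit-combination : ∀ {k k'} a b → k ℕ× 1# ≡ 0# → k' ℕ× 1# ≡ 0# → suc (a ℕ.* k) ≢ b ℕ.* k'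
  no-unit-combination {k} {k'} a b k≡0 k'≡0 eq = 0≢1 (begin
    0#                      ≡⟨ vanishing-multiple b k'≡0 ⟨
    (b ℕ.* k') ℕ× 1#        ≡⟨ cong (_ℕ× 1#) eq ⟨
    1# + (a ℕ.* k) ℕ× 1#    ≡⟨ cong (1# +_) (vanishing-multiple a k≡0) ⟩
    1# + 0#                 ≡⟨ +-identityʳ 1# ⟩
    1#                      ∎)

  base-vanishes : ∀ p m → q ≡ p ℕ.^ m → p ℕ× 1# ≡ 0#
  base-vanishes p m q≡p^m with p ℕ× 1# ≟ 0#
  ... | yes p≡0 = p≡0
  ... | no p≢0 = contradiction (trans (sym (×1-homo-^ p m)) (trans (cong (_ℕ× 1#) (sym q≡p^m)) q×1≡0))
                               (^-nonZero m p≢0)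

  characteristic : ∀ {p m n} → Prime p → q ≡ p ℕ.^ m → n ℕ× 1# ≡ 0# → p ∣ n
  characteristic {p} {m} {n} p-prime q≡p^m n≡0 with p ∣? n
  ... | yes p∣n = p∣n
  ... | no p∤n with coprime-Bézout (∤⇒coprime p-prime p∤n)
  ...   | Bézout.+- x y eq = contradiction eq (no-unit-combination y x n≡0 (base-vanishes p m q≡p^m))
  ...   | Bézout.-+ x y eq = contradiction eq (no-unit-combination x y (base-vanishes p m q≡p^m) n≡0)

  2#≢0# : ∀ {p m} → Prime p → ¬ 2 ∣ p → q ≡ p ℕ.^ m → 2# ≢ 0#
  2#≢0# {p} {m} p-prime 2∤p q≡p^m 2≡0
    with prime⇒irreducible prime[2] (characteristic {p} {m} p-prime q≡p^m (trans 2ℕ×1≡2# 2≡0))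
  ... | inj₁ refl = ¬prime[1] p-prime
  ... | inj₂ refl = 2∤p ∣-refl

  characteristic-^ : ∀ {p m a n} .{{_ : NonZero a}} → Prime p → q ≡ p ℕ.^ m →
                     (a ℕ× 1#) ^ n ≡ 1# → p ∣ a ℕ.^ n ℕ.∸ 1
  characteristic-^ {p} {m} {a} {n} p-prime q≡p^m a^n≡1 =
    characteristic {p} {m} p-prime q≡p^m (+-cancelˡ 1# _ 0# (begin
      1# + (a ℕ.^ n ℕ.∸ 1) ℕ× 1#   ≡⟨ cong (_ℕ× 1#) (ℕ.m+[n∸m]≡n (ℕ.m^n>0 a n)) ⟩
      (a ℕ.^ n) ℕ× 1#              ≡⟨ ×1-homo-^ a n ⟩
      (a ℕ× 1#) ^ n                ≡⟨ a^n≡1 ⟩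
      1#                           ≡⟨ +-identityʳ 1# ⟨
      1# + 0#                      ∎))

  injective⇒strictlySurjective : ∀ {f : Carrier → Carrier} → Injective _≡_ _≡_ f → StrictlySurjective _≡_ f
  injective⇒strictlySurjective {f} f-inj y
    with Fin-injective⇒strictlySurjective {f = toFin ∘ f ∘ fromFin}
           (fromFin-injective ∘ f-inj ∘ toFin-injective) (toFin y)
  ... | i , eq = fromFin i , toFin-injective eq

  module PrimitiveElement (γ : Carrier) (γ-primitive : IsPrimitive γ) where

    γ≢0 : γ ≢ 0#
    γ≢0 = proj₁ γ-primitive

    pow-≡⇒pow-∸≡1 : ∀ {a b} → a < b → γ ^ a ≡ γ ^ b → γ ^ (b ℕ.∸ a) ≡ 1#
    pow-≡⇒pow-∸≡1 {a} {b} a<b eq = *-cancelˡ (^-nonZero a γ≢0) (begin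
      γ ^ a * γ ^ (b ℕ.∸ a)   ≡⟨ ^-homo-* γ a (b ℕ.∸ a) ⟨
      γ ^ (a ℕ.+ (b ℕ.∸ a))   ≡⟨ cong (γ ^_) (ℕ.m+[n∸m]≡n (ℕ.<⇒≤ a<b)) ⟩
      γ ^ b                   ≡⟨ eq ⟨
      γ ^ a                   ≡⟨ *-identityʳ (γ ^ a) ⟨
      γ ^ a * 1#              ∎)

    IsPeriod : ℕ → Set
    IsPeriod k = 1 ≤ k × γ ^ k ≡ 1#

    period : ∃ IsPeriod
    period with pigeonhole (ℕ.n<1+n q) (λ (i : Fin (suc q)) → toFin (γ ^ toℕ i))
    ... | i , j , i<j , eq = toℕ j ℕ.∸ toℕ i , ℕ.m<n⇒0<n∸m i<j , pow-≡⇒pow-∸≡1 i<j (toFin-injective eq)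

    least-period : ∃ λ n → IsPeriod n × (∀ {m} → m < n → ¬ IsPeriod m)
    least-period = least-witness (λ k → 1 ℕ.≤? k ×-dec γ ^ k ≟ 1#) (proj₂ period)

    order : ℕ
    order = proj₁ least-period

    instance
      order-nonZero : NonZero order
      order-nonZero = ℕ.>-nonZero (proj₁ (proj₁ (proj₂ least-period)))

    pow-order≡1 : γ ^ order ≡ 1#
    pow-order≡1 = proj₂ (proj₁ (proj₂ least-period))

    pow-injective-below-order : ∀ {a b} → a < order → b < order → γ ^ a ≡ γ ^ b → a ≡ b
    pow-injective-below-order {a} {b} a<n b<n eq with ℕ.<-cmp a b
    ... | tri≈ _ a≡b _ = a≡b
    ... | tri< a<b _ _ = contradiction (ℕ.m<n⇒0<n∸m a<b , pow-≡⇒pow-∸≡1 a<b eq)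
                                       (proj₂ (proj₂ least-period) (ℕ.≤-<-trans (ℕ.m∸n≤m b a) b<n))
    ... | tri> _ _ b<a = contradiction (ℕ.m<n⇒0<n∸m b<a , pow-≡⇒pow-∸≡1 b<a (sym eq))
                                       (proj₂ (proj₂ least-period) (ℕ.≤-<-trans (ℕ.m∸n≤m a b) a<n))

    pow-+-multiple : ∀ a k → γ ^ (a ℕ.+ k ℕ.* order) ≡ γ ^ a
    pow-+-multiple a k = begin
      γ ^ (a ℕ.+ k ℕ.* order)     ≡⟨ ^-homo-* γ a (k ℕ.* order) ⟩
      γ ^ a * γ ^ (k ℕ.* order)   ≡⟨ cong (λ i → γ ^ a * γ ^ i) (ℕ.*-comm k order) ⟩
      γ ^ a * γ ^ (order ℕ.* k)   ≡⟨ cong (γ ^ a *_) (^-assocʳ γ order k) ⟨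
      γ ^ a * (γ ^ order) ^ k     ≡⟨ cong (λ x → γ ^ a * x ^ k) pow-order≡1 ⟩
      γ ^ a * 1# ^ k              ≡⟨ cong (γ ^ a *_) (1^ k) ⟩
      γ ^ a * 1#                  ≡⟨ *-identityʳ (γ ^ a) ⟩
      γ ^ a                       ∎

    ≡-mod-order⇒pow-≡ : ∀ {a b} → a ≡ b [mod order ] → γ ^ a ≡ γ ^ b
    ≡-mod-order⇒pow-≡ {a} {b} (x , y , eq) =
      trans (sym (pow-+-multiple a x)) (trans (cong (γ ^_) eq) (pow-+-multiple b y))

    pow-≡⇒≡-mod-order : ∀ {a b} → γ ^ a ≡ γ ^ b → a ≡ b [mod order ]
    pow-≡⇒≡-mod-order {a} {b} eq = %≡⇒≡-mod (pow-injective-below-order (m%n<n a order) (m%n<n b order)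
      (trans (≡-mod-order⇒pow-≡ (≡-mod-sym (≡-mod-% a order)))
             (trans eq (≡-mod-order⇒pow-≡ (≡-mod-% b order)))))

    enumerate : Fin (suc order) → Carrier
    enumerate zero = 0#
    enumerate (suc i) = γ ^ toℕ i

    enumerate-injective : Injective _≡_ _≡_ (toFin ∘ enumerate)
    enumerate-injective {zero} {zero} _ = refl
    enumerate-injective {zero} {suc j} eq = contradiction (sym (toFin-injective eq)) (^-nonZero (toℕ j) γ≢0)
    enumerate-injective {suc i} {zero} eq = contradiction (toFin-injective eq) (^-nonZero (toℕ i) γ≢0)
    enumerate-injective {suc i} {suc j} eq = cong suc (toℕ-injective
      (pow-injective-below-order (toℕ<n i) (toℕ<n j) (toFin-injective eq)))

    enumerate-surjective : StrictlySurjective _≡_ (toFin ∘ enumerate)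
    enumerate-surjective y with fromFin y ≟ 0#
    ... | yes y≡0 = zero , trans (cong toFin (sym y≡0)) (toFin-fromFin y)
    ... | no y≢0 with proj₂ γ-primitive (fromFin y) y≢0
    ...   | b , γ^b≡y = suc (fromℕ< (m%n<n b order)) , trans (cong toFin (begin
      γ ^ toℕ (fromℕ< (m%n<n b order))  ≡⟨ cong (γ ^_) (toℕ-fromℕ< (m%n<n b order)) ⟩
      γ ^ (b % order)                   ≡⟨ ≡-mod-order⇒pow-≡ (≡-mod-% b order) ⟨
      γ ^ b                             ≡⟨ γ^b≡y ⟩
      fromFin y                         ∎)) (toFin-fromFin y)

    q∸1≡order : q ℕ.∸ 1 ≡ order
    q∸1≡order = cong ℕ.pred (cantor-schröder-bernstein (section-injective enumerate-surjective) enumerate-injective)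

    ≡-mod⇒pow-≡ : ∀ {a b} → a ≡ b [mod q ℕ.∸ 1 ] → γ ^ a ≡ γ ^ b
    ≡-mod⇒pow-≡ {a} {b} = ≡-mod-order⇒pow-≡ ∘ subst (a ≡ b [mod_]) q∸1≡order

    pow-≡⇒≡-mod : ∀ {a b} → γ ^ a ≡ γ ^ b → a ≡ b [mod q ℕ.∸ 1 ]
    pow-≡⇒≡-mod {a} {b} = subst (a ≡ b [mod_]) (sym q∸1≡order) ∘ pow-≡⇒≡-mod-order

    zero-or-power : ∀ x → x ≡ 0# ⊎ ∃ λ i → γ ^ i ≡ x
    zero-or-power x with x ≟ 0#
    ... | yes x≡0 = inj₁ x≡0
    ... | no x≢0 = inj₂ (proj₂ γ-primitive x x≢0)

    -- Index of x with respect to γ; the junk value at 0# is never used.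
    ind : Carrier → ℕ
    ind x with x ≟ 0#
    ... | yes _ = 0
    ... | no x≢0 = proj₁ (proj₂ γ-primitive x x≢0)

    pow-ind : ∀ {x} → x ≢ 0# → γ ^ ind x ≡ x
    pow-ind {x} x≢0 with x ≟ 0#
    ... | yes x≡0 = contradiction x≡0 x≢0
    ... | no x≢0 = proj₂ (proj₂ γ-primitive x x≢0)

module Criterion
  {p m q l e r s : ℕ} (p-prime : Prime p) (2∤p : ¬ 2 ∣ p) (q≡p^m : q ≡ p ℕ.^ m)
  (2∤l : ¬ 2 ∣ l) (gcd[l,e]≡1 : gcd l e ≡ 1) (1≤r : 1 ≤ r)
  (l∣r+es : l ∣ r ℕ.+ e ℕ.* s) (q∸1≡ls : q ℕ.∸ 1 ≡ l ℕ.* s)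
  (F : FiniteField q) (γ : FiniteField.Carrier F) (γ-primitive : FiniteField.IsPrimitive F γ)
  where

  open import Data.Nat using (_+_; _*_; _∸_)
  open import Data.Nat.Tactic.RingSolver using (solve-∀)
  open FiniteField F renaming (_+_ to _⊕_; _*_ to _·_)
  open FieldProperties F
  open PrimitiveElement γ γ-primitive
  open ≡-Reasoning

  N : ℕ
  N = l * s

  instance
    N-nonZero : NonZero N
    N-nonZero = subst NonZero (trans (sym q∸1≡order) q∸1≡ls) order-nonZero

    l-nonZero : NonZero l
    l-nonZero = ℕ.m*n≢0⇒m≢0 l

    s-nonZero : NonZero s
    s-nonZero = ℕ.m*n≢0⇒n≢0 l

  coprime[l,2] : Coprime l 2
  coprime[l,2] = Coprimality.sym (∤⇒coprime prime[2] 2∤l)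

  coprime[l,e] : Coprime l e
  coprime[l,e] = gcd≡1⇒coprime gcd[l,e]≡1

  2#≢0 : 2# ≢ 0#
  2#≢0 = 2#≢0# {p} {m} p-prime 2∤p q≡p^m

  ≡-mod-N⇒pow-≡ : ∀ {a b} → a ≡ b [mod N ] → γ ^ a ≡ γ ^ b
  ≡-mod-N⇒pow-≡ {a} {b} = ≡-mod⇒pow-≡ ∘ subst (a ≡ b [mod_]) (sym q∸1≡ls)

  pow-≡⇒≡-mod-N : ∀ {a b} → γ ^ a ≡ γ ^ b → a ≡ b [mod N ]
  pow-≡⇒≡-mod-N {a} {b} = subst (a ≡ b [mod_]) q∸1≡ls ∘ pow-≡⇒≡-mod

  ξ : Carrier
  ξ = γ ^ s

  ξ^≡γ^ : ∀ a → ξ ^ a ≡ γ ^ (s * a)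
  ξ^≡γ^ a = ^-assocʳ γ s a

  ≡-mod-l⇒ξ^-≡ : ∀ {a b} → a ≡ b [mod l ] → ξ ^ a ≡ ξ ^ b
  ≡-mod-l⇒ξ^-≡ {a} {b} a≡b =
    trans (ξ^≡γ^ a) (trans (≡-mod-N⇒pow-≡ (≡-mod-scale s a≡b)) (sym (ξ^≡γ^ b)))

  ξ^-≡⇒≡-mod-l : ∀ {a b} → ξ ^ a ≡ ξ ^ b → a ≡ b [mod l ]
  ξ^-≡⇒≡-mod-l {a} {b} eq = ≡-mod-unscale s (pow-≡⇒≡-mod-N (trans (sym (ξ^≡γ^ a)) (trans eq (ξ^≡γ^ b))))

  [γ^a]^s≡ξ^a : ∀ a → (γ ^ a) ^ s ≡ ξ ^ a
  [γ^a]^s≡ξ^a a = trans (^-assocʳ γ a s) (trans (cong (γ ^_) (ℕ.*-comm a s)) (sym (ξ^≡γ^ a)))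

  w : ℕ → Carrier
  w k = ξ ^ (e * k)

  A : ℕ → Carrier
  A k = A[_,_,_,_] F γ s e k

  D : ℕ → Carrier
  D k = 1# - w k

  w-periodic : ∀ {j k} → j ≡ k [mod l ] → w j ≡ w k
  w-periodic j≡k = ≡-mod-l⇒ξ^-≡ (*-congˡ-≡-mod e j≡k)

  A-periodic : ∀ {j k} → j ≡ k [mod l ] → A j ≡ A k
  A-periodic j≡k = cong (_⊕ 1#) (w-periodic j≡k)

  D-periodic : ∀ {j k} → j ≡ k [mod l ] → D j ≡ D k
  D-periodic j≡k = cong (λ x → 1# - x) (w-periodic j≡k)

  w0≡1 : w 0 ≡ 1#
  w0≡1 = cong (ξ ^_) (ℕ.*-zeroʳ e)

  A0≡2# : A 0 ≡ 2#
  A0≡2# = cong (_⊕ 1#) w0≡1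

  w≡1⇒≡0 : ∀ {k} → w k ≡ 1# → k ≡ 0 [mod l ]
  w≡1⇒≡0 {k} wk≡1 = *-cancelˡ-≡-mod coprime[l,e] (ξ^-≡⇒≡-mod-l {e * k} {e * 0} (trans wk≡1 (sym w0≡1)))

  w-double : ∀ k → w k · w k ≡ w (2 * k)
  w-double k = trans (sym (^-homo-* ξ (e * k) (e * k))) (cong (ξ ^_) (double e k))
    where
    double : ∀ e k → e * k + e * k ≡ e * (2 * k)
    double = solve-∀

  A·D≡D[2k] : ∀ k → A k · D k ≡ D (2 * k)
  A·D≡D[2k] k = trans ([x+1][1-x]≡1-x² (w k)) (cong (λ x → 1# - x) (w-double k))

  D≡0⇒≡0 : ∀ {k} → D k ≡ 0# → k ≡ 0 [mod l ]
  D≡0⇒≡0 {k} Dk≡0 = w≡1⇒≡0 (sym (x∙y⁻¹≈ε⇒x≈y 1# (w k) Dk≡0))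

  -- If A k = 0 then D (2k) = 0, so l ∣ 2k, hence l ∣ k and A k = 2.
  A≢0 : ∀ k → A k ≢ 0#
  A≢0 k Ak≡0 = 2#≢0 (begin
    2#          ≡⟨ A0≡2# ⟨
    A 0         ≡⟨ A-periodic (≡-mod-sym k≡0) ⟩
    A k         ≡⟨ Ak≡0 ⟩
    0#          ∎)
    where
    2k≡0 : (2 * k) ≡ 0 [mod l ]
    2k≡0 = D≡0⇒≡0 (trans (sym (A·D≡D[2k] k)) (trans (cong (_· D k) Ak≡0) (zeroˡ (D k))))
    k≡0 : k ≡ 0 [mod l ]
    k≡0 = *-cancelˡ-≡-mod coprime[l,2] 2k≡0

  D≢0 : ∀ {k} → 1 ≤ k → k < l → D k ≢ 0#
  D≢0 1≤k k<l Dk≡0 = ℕ.>⇒≢ 1≤k (≡-mod⇒≡ k<l (ℕ.>-nonZero⁻¹ l) (D≡0⇒≡0 Dk≡0))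

  P : Carrier → Carrier
  P = P[_,_,_] F r e s

  P-pow : ∀ i → P (γ ^ i) ≡ γ ^ (r * i) · A i
  P-pow i = cong₂ _·_ (trans (^-assocʳ γ i r) (cong (γ ^_) (ℕ.*-comm i r)))
    (cong (_⊕ 1#) (trans (^-assocʳ γ i (e * s)) (trans (cong (γ ^_) (rearrange i e s)) (sym (ξ^≡γ^ (e * i))))))
    where
    rearrange : ∀ i e s → i * (e * s) ≡ s * (e * i)
    rearrange = solve-∀

  P-zero : P 0# ≡ 0#
  P-zero = trans (cong (_· (0# ^ (e * s) ⊕ 1#)) 0^r≡0) (zeroˡ _)
    where
    0^r≡0 : 0# ^ r ≡ 0#
    0^r≡0 = trans (cong (0# ^_) (sym (ℕ.m+[n∸m]≡n 1≤r))) (zeroˡ _)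

  P-pow≢0 : ∀ i → P (γ ^ i) ≢ 0#
  P-pow≢0 i = *-nonZero (^-nonZero (r * i) γ≢0) (A≢0 i) ∘ trans (sym (P-pow i))

  P-pow-cong : ∀ {i j} → i ≡ j [mod l ] → (r * i) ≡ (r * j) [mod N ] → P (γ ^ i) ≡ P (γ ^ j)
  P-pow-cong {i} {j} i≡j ri≡rj =
    trans (P-pow i) (trans (cong₂ _·_ (≡-mod-N⇒pow-≡ ri≡rj) (A-periodic i≡j)) (sym (P-pow j)))

  G : ℕ → Carrier
  G k = ξ ^ (k * r) · A k ^ s

  P-pow^s : ∀ i → P (γ ^ i) ^ s ≡ G i
  P-pow^s i = begin
    P (γ ^ i) ^ s                  ≡⟨ cong (_^ s) (P-pow i) ⟩
    (γ ^ (r * i) · A i) ^ s        ≡⟨ ^-distrib-* _ (A i) s ⟩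
    (γ ^ (r * i)) ^ s · A i ^ s    ≡⟨ cong (_· A i ^ s) ([γ^a]^s≡ξ^a (r * i)) ⟩
    ξ ^ (r * i) · A i ^ s          ≡⟨ cong (λ n → ξ ^ n · A i ^ s) (ℕ.*-comm r i) ⟩
    G i                            ∎

  G-periodic : ∀ {j k} → j ≡ k [mod l ] → G j ≡ G k
  G-periodic {j} {k} j≡k = cong₂ (λ x y → x · y ^ s)
    (≡-mod-l⇒ξ^-≡ (*-congʳ-≡-mod r j≡k)) (A-periodic j≡k)

  G≡ξ^ : ∀ {k c} → γ ^ c ≡ A k → G k ≡ ξ ^ (k * r + c)
  G≡ξ^ {k} {c} γ^c≡Ak = begin
    ξ ^ (k * r) · A k ^ s          ≡⟨ cong (λ x → ξ ^ (k * r) · x ^ s) γ^c≡Ak ⟨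
    ξ ^ (k * r) · (γ ^ c) ^ s      ≡⟨ cong (ξ ^ (k * r) ·_) ([γ^a]^s≡ξ^a c) ⟩
    ξ ^ (k * r) · ξ ^ c            ≡⟨ ^-homo-* ξ (k * r) c ⟨
    ξ ^ (k * r + c)                ∎

  A≡w·A[l∸j] : ∀ {j} → j ≤ l → A j ≡ w j · A (l ∸ j)
  A≡w·A[l∸j] {j} j≤l = sym (begin
    w j · (w (l ∸ j) ⊕ 1#)          ≡⟨ distribˡ (w j) _ 1# ⟩
    w j · w (l ∸ j) ⊕ w j · 1#      ≡⟨ cong₂ _⊕_ (sym (^-homo-* ξ (e * j) _)) (*-identityʳ (w j)) ⟩
    ξ ^ (e * j + e * (l ∸ j)) ⊕ w j ≡⟨ cong (_⊕ w j) (≡-mod-l⇒ξ^-≡ {b = 0} el≡0) ⟩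
    1# ⊕ w j                        ≡⟨ +-comm 1# (w j) ⟩
    A j                             ∎)
    where
    el≡0 : (e * j + e * (l ∸ j)) ≡ 0 [mod l ]
    el≡0 = subst (_≡ 0 [mod l ]) (trans (cong (e *_) (sym (ℕ.m+[n∸m]≡n j≤l))) (ℕ.*-distribˡ-+ e j (l ∸ j)))
                 (multiple-≡-mod-0 e l)

  -- This is where l ∣ r + e s enters.
  ξ^[jr]·w^s≡1 : ∀ j → ξ ^ (j * r) · w j ^ s ≡ 1#
  ξ^[jr]·w^s≡1 j = begin
    ξ ^ (j * r) · w j ^ s             ≡⟨ cong (ξ ^ (j * r) ·_) (^-assocʳ ξ (e * j) s) ⟩
    ξ ^ (j * r) · ξ ^ (e * j * s)     ≡⟨ ^-homo-* ξ (j * r) (e * j * s) ⟨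
    ξ ^ (j * r + e * j * s)           ≡⟨ ≡-mod-l⇒ξ^-≡ {b = 0} jr+ejs≡0 ⟩
    1#                                ∎
    where
    c = _∣_.quotient l∣r+es
    expand : ∀ j r e s → j * (r + e * s) ≡ j * r + e * j * s
    expand = solve-∀
    jcl≡ : j * c * l ≡ j * r + e * j * s
    jcl≡ = trans (ℕ.*-assoc j c l) (trans (cong (j *_) (sym (_∣_.equality l∣r+es))) (expand j r e s))
    jr+ejs≡0 : (j * r + e * j * s) ≡ 0 [mod l ]
    jr+ejs≡0 = subst (_≡ 0 [mod l ]) jcl≡ (multiple-≡-mod-0 (j * c) l)

  G-reflect : ∀ {j} → j ≤ l → G j ≡ A (l ∸ j) ^ s
  G-reflect {j} j≤l = begin
    ξ ^ (j * r) · A j ^ s                        ≡⟨ cong (λ x → ξ ^ (j * r) · x ^ s) (A≡w·A[l∸j] j≤l) ⟩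
    ξ ^ (j * r) · (w j · A (l ∸ j)) ^ s          ≡⟨ cong (ξ ^ (j * r) ·_) (^-distrib-* (w j) _ s) ⟩
    ξ ^ (j * r) · (w j ^ s · A (l ∸ j) ^ s)      ≡⟨ *-assoc _ _ _ ⟨
    ξ ^ (j * r) · w j ^ s · A (l ∸ j) ^ s        ≡⟨ cong (_· A (l ∸ j) ^ s) (ξ^[jr]·w^s≡1 j) ⟩
    1# · A (l ∸ j) ^ s                           ≡⟨ *-identityˡ _ ⟩
    A (l ∸ j) ^ s                                ∎

  G-Injective : Set
  G-Injective = ∀ {j k} → j < l → k < l → G j ≡ G k → j ≡ k

  A^s-Distinct : Set
  A^s-Distinct = ∀ j k → 1 ≤ j → j < l → 1 ≤ k → k < l → ¬ (j ≡ k) → ¬ (A j ^ s ≡ A k ^ s)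

  IndexCondition : Set
  IndexCondition = ∀ k → 1 ≤ k → k < l → ∀ b c → γ ^ b ≡ A k → γ ^ c ≡ 2# → ¬ ((b + k * r) ≡ c [mod l ])

  G≡G0⇔index : ∀ {k b c} → γ ^ b ≡ A k → γ ^ c ≡ 2# → G k ≡ G 0 ⇔ ((b + k * r) ≡ c [mod l ])
  G≡G0⇔index {k} {b} {c} γ^b≡Ak γ^c≡2 = mk⇔
    (λ Gk≡G0 → ξ^-≡⇒≡-mod-l (trans (sym Gk≡ξ^[b+kr]) (trans Gk≡G0 G0≡ξ^c)))
    (λ b+kr≡c → trans Gk≡ξ^[b+kr] (trans (≡-mod-l⇒ξ^-≡ b+kr≡c) (sym G0≡ξ^c)))
    where
    Gk≡ξ^[b+kr] : G k ≡ ξ ^ (b + k * r)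
    Gk≡ξ^[b+kr] = trans (G≡ξ^ γ^b≡Ak) (cong (ξ ^_) (ℕ.+-comm (k * r) b))
    G0≡ξ^c : G 0 ≡ ξ ^ c
    G0≡ξ^c = G≡ξ^ {0} {c} (trans γ^c≡2 (sym A0≡2#))

  reflect-injective : ∀ {j k} → j < l → k < l → l ∸ j ≡ l ∸ k → j ≡ k
  reflect-injective j<l k<l eq =
    trans (sym (ℕ.m∸[m∸n]≡n (ℕ.<⇒≤ j<l))) (trans (cong (l ∸_) eq) (ℕ.m∸[m∸n]≡n (ℕ.<⇒≤ k<l)))

  G-injective⇒A^s-distinct : G-Injective → A^s-Distinct
  G-injective⇒A^s-distinct G-inj j k 1≤j j<l 1≤k k<l j≢k Aj^s≡Ak^s = j≢k (reflect-injective j<l k<l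
    (G-inj (ℕ.∸-monoʳ-< 1≤j (ℕ.<⇒≤ j<l)) (ℕ.∸-monoʳ-< 1≤k (ℕ.<⇒≤ k<l)) (begin
      G (l ∸ j)                ≡⟨ G-reflect (ℕ.m∸n≤m l j) ⟩
      A (l ∸ (l ∸ j)) ^ s      ≡⟨ cong (λ i → A i ^ s) (ℕ.m∸[m∸n]≡n (ℕ.<⇒≤ j<l)) ⟩
      A j ^ s                  ≡⟨ Aj^s≡Ak^s ⟩
      A k ^ s                  ≡⟨ cong (λ i → A i ^ s) (ℕ.m∸[m∸n]≡n (ℕ.<⇒≤ k<l)) ⟨
      A (l ∸ (l ∸ k)) ^ s      ≡⟨ G-reflect (ℕ.m∸n≤m l k) ⟨
      G (l ∸ k)                ∎)))

  G-injective⇒index-condition : G-Injective → IndexCondition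
  G-injective⇒index-condition G-inj k 1≤k k<l b c γ^b≡Ak γ^c≡2 b+kr≡c =
    ℕ.>⇒≢ 1≤k (G-inj k<l (ℕ.>-nonZero⁻¹ l) (Equivalence.from (G≡G0⇔index γ^b≡Ak γ^c≡2) b+kr≡c))

  index⇒G≢G0 : IndexCondition → ∀ {k} → 1 ≤ k → k < l → G k ≢ G 0
  index⇒G≢G0 index {k} 1≤k k<l Gk≡G0 = index k 1≤k k<l (ind (A k)) (ind 2#) γ^b≡Ak γ^c≡2
    (Equivalence.to (G≡G0⇔index γ^b≡Ak γ^c≡2) Gk≡G0)
    where
    γ^b≡Ak = pow-ind (A≢0 k)
    γ^c≡2 = pow-ind 2#≢0

  conditions⇒G-injective : A^s-Distinct → IndexCondition → G-Injective
  conditions⇒G-injective distinct index {zero} {zero} _ _ _ = refl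
  conditions⇒G-injective distinct index {zero} {suc k} _ k<l G0≡Gk =
    contradiction (sym G0≡Gk) (index⇒G≢G0 index ℕ.z<s k<l)
  conditions⇒G-injective distinct index {suc j} {zero} j<l _ Gj≡G0 =
    contradiction Gj≡G0 (index⇒G≢G0 index ℕ.z<s j<l)
  conditions⇒G-injective distinct index {suc j} {suc k} j<l k<l Gj≡Gk with (l ∸ suc j) ℕ.≟ (l ∸ suc k)
  ... | yes eq = reflect-injective j<l k<l eq
  ... | no neq = contradiction (trans (sym (G-reflect (ℕ.<⇒≤ j<l))) (trans Gj≡Gk (G-reflect (ℕ.<⇒≤ k<l))))
                   (distinct (l ∸ suc j) (l ∸ suc k) (ℕ.m<n⇒0<n∸m j<l) (ℕ.∸-monoʳ-< ℕ.z<s (ℕ.<⇒≤ j<l))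
                             (ℕ.m<n⇒0<n∸m k<l) (ℕ.∸-monoʳ-< ℕ.z<s (ℕ.<⇒≤ k<l)) neq)

  P-pow-≡⇒pow-≡ : Coprime s r → G-Injective → ∀ {i j} → P (γ ^ i) ≡ P (γ ^ j) → γ ^ i ≡ γ ^ j
  P-pow-≡⇒pow-≡ coprime G-inj {i} {j} eq = ≡-mod-N⇒pow-≡ (≡-mod-lift coprime i≡j ri≡rj)
    where
    i≡j : i ≡ j [mod l ]
    i≡j = %≡⇒≡-mod (G-inj (m%n<n i l) (m%n<n j l) (begin
      G (i % l)          ≡⟨ G-periodic (≡-mod-% i l) ⟨
      G i                ≡⟨ P-pow^s i ⟨
      P (γ ^ i) ^ s      ≡⟨ cong (_^ s) eq ⟩
      P (γ ^ j) ^ s      ≡⟨ P-pow^s j ⟩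
      G j                ≡⟨ G-periodic (≡-mod-% j l) ⟩
      G (j % l)          ∎))
    ri≡rj : (r * i) ≡ (r * j) [mod N ]
    ri≡rj = pow-≡⇒≡-mod-N (*-cancelʳ (A≢0 j) (begin
      γ ^ (r * i) · A j  ≡⟨ cong (γ ^ (r * i) ·_) (A-periodic i≡j) ⟨
      γ ^ (r * i) · A i  ≡⟨ P-pow i ⟨
      P (γ ^ i)          ≡⟨ eq ⟩
      P (γ ^ j)          ≡⟨ P-pow j ⟩
      γ ^ (r * j) · A j  ∎))

  P-injective : Coprime s r → G-Injective → Injective _≡_ _≡_ P
  P-injective coprime G-inj {x} {y} Px≡Py with zero-or-power x | zero-or-power y
  ... | inj₁ refl | inj₁ refl = refl
  ... | inj₁ refl | inj₂ (j , refl) = contradiction (trans (sym Px≡Py) P-zero) (P-pow≢0 j)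
  ... | inj₂ (i , refl) | inj₁ refl = contradiction (trans Px≡Py P-zero) (P-pow≢0 i)
  ... | inj₂ (i , refl) | inj₂ (j , refl) = P-pow-≡⇒pow-≡ coprime G-inj {i} {j} Px≡Py

  -- If d = gcd(r, s) > 1, then j = l s / d collides with 0.
  P-injective⇒gcd≡1 : Injective _≡_ _≡_ P → gcd r s ≡ 1
  P-injective⇒gcd≡1 P-inj with gcd r s ℕ.≟ 1 | gcd[m,n]∣m r s | gcd[m,n]∣n r s
  ... | yes d≡1 | _ | _ = d≡1
  ... | no d≢1 | divides r′ r≡r′d | divides s′ s≡s′d =
    contradiction (≡-mod⇒≡ j<N (ℕ.>-nonZero⁻¹ N) (pow-≡⇒≡-mod-N (P-inj (P-pow-cong j≡0 rj≡0))))
                  (ℕ.>⇒≢ (ℕ.>-nonZero⁻¹ j {{ℕ.m*n≢0 l s′}}))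
    where
    d = gcd r s
    instance
      s′-nonZero : NonZero s′
      s′-nonZero = ℕ.m*n≢0⇒m≢0 s′ {{subst NonZero s≡s′d s-nonZero}}
    j = l * s′
    1<d : 1 < d
    1<d = ℕ.≤∧≢⇒< (ℕ.n≢0⇒n>0 (gcd[m,n]≢0 r s (inj₂ (ℕ.≢-nonZero⁻¹ s)))) (d≢1 ∘ sym)
    j<N : j < N
    j<N = ℕ.*-monoʳ-< l (subst (s′ <_) (sym s≡s′d) (ℕ.m<m*n s′ d 1<d))
    j≡0 : j ≡ 0 [mod l ]
    j≡0 = subst (_≡ 0 [mod l ]) (ℕ.*-comm s′ l) (multiple-≡-mod-0 s′ l)
    rearrange : ∀ r′ d l s′ → r′ * d * (l * s′) ≡ r′ * (l * (s′ * d))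
    rearrange = solve-∀
    rj≡0 : (r * j) ≡ (r * 0) [mod N ]
    rj≡0 = subst₂ (_≡_[mod N ])
      (sym (trans (cong (_* j) r≡r′d) (trans (rearrange r′ d l s′) (cong (λ t → r′ * (l * t)) (sym s≡s′d)))))
      (sym (ℕ.*-zeroʳ r)) (multiple-≡-mod-0 r′ N)

  ψ : Fin l → Fin l
  ψ k = fromℕ< (m%n<n (toℕ k * r + ind (A (toℕ k))) l)

  G≡ξ^ψ : ∀ k → G (toℕ k) ≡ ξ ^ toℕ (ψ k)
  G≡ξ^ψ k = trans (G≡ξ^ (pow-ind (A≢0 (toℕ k))))
    (≡-mod-l⇒ξ^-≡ (≡-mod-trans (≡-mod-% _ l) (≡⇒≡-mod (sym (toℕ-fromℕ< _)))))

  P-surjective⇒ψ-surjective : StrictlySurjective _≡_ P → StrictlySurjective _≡_ ψ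
  P-surjective⇒ψ-surjective P-surj t with P-surj (γ ^ toℕ t)
  ... | x , Px≡γ^t with zero-or-power x
  ...   | inj₁ refl = contradiction (trans (sym Px≡γ^t) P-zero) (^-nonZero (toℕ t) γ≢0)
  ...   | inj₂ (i , refl) = k , toℕ-injective (≡-mod⇒≡ (toℕ<n (ψ k)) (toℕ<n t) (ξ^-≡⇒≡-mod-l (begin
    ξ ^ toℕ (ψ k)          ≡⟨ G≡ξ^ψ k ⟨
    G (toℕ k)              ≡⟨ cong G (toℕ-fromℕ< (m%n<n i l)) ⟩
    G (i % l)              ≡⟨ G-periodic (≡-mod-% i l) ⟨
    G i                    ≡⟨ P-pow^s i ⟨
    P (γ ^ i) ^ s          ≡⟨ cong (_^ s) Px≡γ^t ⟩
    (γ ^ toℕ t) ^ s        ≡⟨ [γ^a]^s≡ξ^a (toℕ t) ⟩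
    ξ ^ toℕ t              ∎)))
    where
    k = fromℕ< (m%n<n i l)

  P-surjective⇒G-injective : StrictlySurjective _≡_ P → G-Injective
  P-surjective⇒G-injective P-surj {j} {k} j<l k<l Gj≡Gk =
    trans (sym (toℕ-fromℕ< j<l)) (trans (cong toℕ (ψ-injective (toℕ-injective ψj≡ψk))) (toℕ-fromℕ< k<l))
    where
    ψ-injective = Fin-strictlySurjective⇒injective (P-surjective⇒ψ-surjective P-surj)
    ψj≡ψk : toℕ (ψ (fromℕ< j<l)) ≡ toℕ (ψ (fromℕ< k<l))
    ψj≡ψk = ≡-mod⇒≡ (toℕ<n _) (toℕ<n _) (ξ^-≡⇒≡-mod-l (begin
      ξ ^ toℕ (ψ (fromℕ< j<l))   ≡⟨ G≡ξ^ψ (fromℕ< j<l) ⟨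
      G (toℕ (fromℕ< j<l))       ≡⟨ cong G (toℕ-fromℕ< j<l) ⟩
      G j                        ≡⟨ Gj≡Gk ⟩
      G k                        ≡⟨ cong G (toℕ-fromℕ< k<l) ⟨
      G (toℕ (fromℕ< k<l))       ≡⟨ G≡ξ^ψ (fromℕ< k<l) ⟩
      ξ ^ toℕ (ψ (fromℕ< k<l))   ∎))

  b : ℕ → ℕ
  b k = ind (A k)

  d : ℕ → ℕ
  d k = ind (D k)

  double : Fin l → Fin l
  double k = fromℕ< (m%n<n (2 * toℕ k) l)

  double-injective : Injective _≡_ _≡_ double
  double-injective {i} {j} eq = toℕ-injective (≡-mod⇒≡ (toℕ<n i) (toℕ<n j) (*-cancelˡ-≡-mod coprime[l,2]
    (%≡⇒≡-mod (trans (sym (toℕ-fromℕ< _)) (trans (cong toℕ eq) (toℕ-fromℕ< _))))))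

  b+d≡d[2k] : ∀ {k} → 1 ≤ k → k < l → (b k + d k) ≡ d ((2 * k) % l) [mod N ]
  b+d≡d[2k] {k} 1≤k k<l = pow-≡⇒≡-mod-N (begin
    γ ^ (b k + d k)            ≡⟨ ^-homo-* γ (b k) (d k) ⟩
    γ ^ b k · γ ^ d k          ≡⟨ cong₂ _·_ (pow-ind (A≢0 k)) (pow-ind (D≢0 1≤k k<l)) ⟩
    A k · D k                  ≡⟨ A·D≡D[2k] k ⟩
    D (2 * k)                  ≡⟨ D-periodic (≡-mod-% (2 * k) l) ⟩
    D ((2 * k) % l)            ≡⟨ pow-ind (D≢0 1≤2k%l (m%n<n _ l)) ⟨
    γ ^ d ((2 * k) % l)        ∎)
    where
    1≤2k%l : 1 ≤ (2 * k) % l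
    1≤2k%l = ℕ.n≢0⇒n>0 λ 2k%l≡0 → ℕ.>⇒≢ 1≤k (≡-mod⇒≡ k<l (ℕ.>-nonZero⁻¹ l)
      (*-cancelˡ-≡-mod coprime[l,2] (≡-mod-trans (≡-mod-% (2 * k) l) (≡⇒≡-mod 2k%l≡0))))

  -- The doubling identity A k · D k = D (2 k) in index form, summed over all residues k.
  ∑ind-A≡ind-A0 : ∑ {l} (b ∘ toℕ) ≡ b 0 [mod N ]
  ∑ind-A≡ind-A0 = subst (λ i → ∑ {l} (b ∘ toℕ) ≡ b i [mod N ]) (toℕ-fromℕ< 0<l)
    (∑-≡-head (b ∘ toℕ) (d ∘ toℕ) double-injective (fromℕ< 0<l) (toℕ-fromℕ< 0<l) double-0 step)
    where
    0<l = ℕ.>-nonZero⁻¹ l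
    double-0 : toℕ (double (fromℕ< 0<l)) ≡ 0
    double-0 = trans (toℕ-fromℕ< _) (trans (cong (λ i → (2 * i) % l) (toℕ-fromℕ< 0<l)) (m<n⇒m%n≡m 0<l))
    step : ∀ i → 1 ≤ toℕ i → (b (toℕ i) + d (toℕ i)) ≡ d (toℕ (double i)) [mod N ]
    step i 1≤i = subst (λ x → (b (toℕ i) + d (toℕ i)) ≡ d x [mod N ]) (sym (toℕ-fromℕ< _))
                       (b+d≡d[2k] 1≤i (toℕ<n i))

  P-surjective⇒∑ind-A≡0 : StrictlySurjective _≡_ P → ∑ {l} (b ∘ toℕ) ≡ 0 [mod l ]
  P-surjective⇒∑ind-A≡0 P-surj =
    ≡-mod-trans (+-cong-≡-mod (≡-mod-sym ∑kr≡0) (≡-mod-refl {∑ {l} (b ∘ toℕ)}))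
    (≡-mod-trans (≡⇒≡-mod (sym (∑-distrib-+ {l} (λ k → toℕ k * r) (b ∘ toℕ))))
    (≡-mod-trans (∑-≡-mod {l} (λ k → ≡-mod-trans (≡-mod-% _ l) (≡⇒≡-mod (sym (toℕ-fromℕ< _)))))
    (≡-mod-trans (≡⇒≡-mod (sym (sum-reindex ℕ.+-0-commutativeMonoid {l} toℕ ψ-injective)))
    (∑-toℕ≡0-mod-odd 2∤l))))
    where
    ψ-injective = Fin-strictlySurjective⇒injective (P-surjective⇒ψ-surjective P-surj)
    ∑kr≡0 : ∑ {l} (λ k → toℕ k * r) ≡ 0 [mod l ]
    ∑kr≡0 = subst (_≡ 0 [mod l ]) (*-distribʳ-∑ {l} r toℕ) (*-congʳ-≡-mod r (∑-toℕ≡0-mod-odd 2∤l))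

  P-surjective⇒2^s≡1 : StrictlySurjective _≡_ P → 2# ^ s ≡ 1#
  P-surjective⇒2^s≡1 P-surj = begin
    2# ^ s             ≡⟨ cong (_^ s) (trans (sym A0≡2#) (sym (pow-ind (A≢0 0)))) ⟩
    (γ ^ b 0) ^ s      ≡⟨ trans (^-assocʳ γ (b 0) s) (cong (γ ^_) (ℕ.*-comm (b 0) s)) ⟩
    γ ^ (s * b 0)      ≡⟨ ≡-mod-N⇒pow-≡ (≡-mod-trans (*-congˡ-≡-mod s (≡-mod-sym ∑ind-A≡ind-A0))
                                                   (≡-mod-scale s (P-surjective⇒∑ind-A≡0 P-surj))) ⟩
    γ ^ (s * 0)        ≡⟨ cong (γ ^_) (ℕ.*-zeroʳ s) ⟩
    1#                 ∎

  P-surjective⇒p∣2^s∸1 : StrictlySurjective _≡_ P → p ∣ 2 ℕ.^ s ∸ 1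
  P-surjective⇒p∣2^s∸1 P-surj = characteristic-^ {p} {m} {2} {s} p-prime q≡p^m
    (trans (cong (_^ s) 2ℕ×1≡2#) (P-surjective⇒2^s≡1 P-surj))

open import Data.Nat using (_+_; _*_; _∸_; _^_)
open import Function.Consequences.Propositional
  using (surjective⇒strictlySurjective; strictlySurjective⇒surjective)
open FiniteField using (Carrier; 2#; IsPrimitive; IsPermutation) renaming (_^_ to pow)

theorem4p5 : (p m q l e r s : ℕ) → Prime p → ¬ (2 ∣ p) → 1 ≤ m → q ≡ p ^ m →
    1 ≤ l → 1 ≤ e → 1 ≤ r → 1 ≤ s → 3 ≤ l → ¬ (2 ∣ l) → 2 ∣ s → gcd l e ≡ 1 →
    l ∣ r + e * s → q ∸ 1 ≡ l * s →
    (F : FiniteField q) → (γ : Carrier F) → IsPrimitive F γ →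
    IsPermutation F (P[_,_,_] F r e s)
    ⇔ (gcd r s ≡ 1
       × p ∣ 2 ^ s ∸ 1
       × ¬ (l ∣ r)
       × (∀ j k → 1 ≤ j → j < l → 1 ≤ k → k < l → ¬ (j ≡ k) →
            ¬ (pow F (A[_,_,_,_] F γ s e j) s ≡ pow F (A[_,_,_,_] F γ s e k) s))
       × (∀ k → 1 ≤ k → k < l → ∀ b c →
            pow F γ b ≡ A[_,_,_,_] F γ s e k → pow F γ c ≡ 2# F →
            ¬ ((b + k * r) ≡ c [mod l ])))
theorem4p5 p m q l e r s p-prime 2∤p _ q≡p^m _ _ 1≤r _ 3≤l 2∤l _ gcd[l,e]≡1 l∣r+es q∸1≡ls F γ γ-primitive =
  mk⇔ (λ (P-inj , P-surj) → forward P-inj (surjective⇒strictlySurjective P-surj))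
      (λ (gcd[r,s]≡1 , _ , _ , distinct , index) → backward gcd[r,s]≡1 distinct index)
  where
  open FieldProperties F using (injective⇒strictlySurjective)
  open Criterion {m = m} p-prime 2∤p q≡p^m 2∤l gcd[l,e]≡1 1≤r l∣r+es q∸1≡ls
                 F γ γ-primitive

  forward : Injective _≡_ _≡_ P → StrictlySurjective _≡_ P →
            gcd r s ≡ 1 × p ∣ 2 ^ s ∸ 1 × ¬ (l ∣ r) × A^s-Distinct × IndexCondition
  forward P-inj P-surj =
    gcd[r,s]≡1 , P-surjective⇒p∣2^s∸1 P-surj , ∣r+es⇒∤r (ℕ.<⇒≤ 3≤l) gcd[l,e]≡1 gcd[r,s]≡1 l∣r+es ,
    G-injective⇒A^s-distinct G-inj , G-injective⇒index-condition G-inj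
    where
    gcd[r,s]≡1 = P-injective⇒gcd≡1 P-inj
    G-inj = P-surjective⇒G-injective P-surj

  backward : gcd r s ≡ 1 → A^s-Distinct → IndexCondition → IsPermutation F P
  backward gcd[r,s]≡1 distinct index = P-inj , strictlySurjective⇒surjective (injective⇒strictlySurjective P-inj)
    where
    P-inj = P-injective (Coprimality.sym (gcd≡1⇒coprime gcd[r,s]≡1)) (conditions⇒G-injective distinct index)
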